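{- Let $G$ and $H$ be finite digraphs, let $k>1$ be an integer, and for each $x\in V(G)$ let $L(x)\subseteq V(H)$ be a list. Suppose $f$ is a homomorphism of $G\times H^k$ to $H$ consistent with $L$. Run the procedure PreProcessing on $G,H,L$, producing updated lists $L^{\mathrm{new}}(x)\subseteq L(x)$ for all $x\in V(G)$. Then $f$ is a homomorphism consistent with the updated lists $L^{\mathrm{new}}$. In particular, for every $y\in V(G)$ and all $a_1,\dots,a_k\in L^{\mathrm{new}}(y)$ we have $f(y;a_1,\dots,a_k)\in L^{\mathrm{new}}(y)$.
   Context: For a digraph $D$, $V(D)$ is its vertex set and $A(D)$ its arc set; $uv$ denotes the arc $(u,v)$. A function $f$ assigning to each $x\in V(G)$ and each $k$-tuple $a_1,\dots,a_k\in L(x)$ a vertex $f(x;a_1,\dots,a_k)\in V(H)$ is a homomorphism of $G\times H^k$ to $H$ consistent with $L$ if: (List property) for every $x\in V(G)$ and all $a_1,\dots,a_k\in L(x)$, $f(x;a_1,\dots,a_k)\in L(x)$; (Adjacency property) for all $x,y\in V(G)$, all $a_1,\dots,a_k\in L(x)$ and $b_1,\dots,b_k\in L(y)$, if $xy\in A(G)$ and $a_ib_i\in A(H)$ for every $1\le i\le k$, then $f(x;a_1,\dots,a_k)f(y;b_1,\dots,b_k)\in A(H)$. PreProcessing consists of ArcConsistency followed by PairConsistency. ArcConsistency: while there exist an arc $xy\in A(G)$ and $a\in L(x)$ with no $b\in L(y)$ such that $ab\in A(H)$, or an arc $yx\in A(G)$ and $a\in L(x)$ with no $b\in L(y)$ such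 that $ba\in A(H)$, remove $a$ from $L(x)$. PairConsistency: for all $(x,y)\in V(G)\times V(G)$ set $L(x,y)=L(x)\times L(y)$, and set $L(x,x)=\{(a,a): a\in L(x)\}$; for each arc $xy\in A(G)$ remove from $L(x,y)$ every $(a,b)$ with $ab\notin A(H)$; then, while there exist $x,y,z\in V(G)$ and $(a,b)\in L(x,y)$ such that no $c\in L(z)$ satisfies $(a,c)\in L(x,z)$ and $(c,b)\in L(z,y)$, remove $(a,b)$ from $L(x,y)$. -}

module Defs where

open import Data.Nat using (ℕ)
open import Data.Fin using (Fin; _≟_)
open import Data.Bool using (Bool; true; false; T; _∧_; _∨_; not; if_then_else_)
open import Data.Product using (Σ; _×_; _,_)
open import Data.Sum using (_⊎_)
open import Data.Empty using (⊥)
open import Relation.Nullary using (¬_)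
open import Relation.Nullary.Decidable using (⌊_⌋)
open import Relation.Binary.PropositionalEquality using (_≡_)

Digraph : ℕ → Set
Digraph n = Fin n → Fin n → Bool

-- Lists: L x a = true  iff  a ∈ L(x),  for x ∈ V(G) = Fin n, a ∈ V(H) = Fin m.
Lists : ℕ → ℕ → Set
Lists n m = Fin n → Fin m → Bool

-- Pair lists: P x y a b = true  iff  (a , b) ∈ L(x , y).
PairLists : ℕ → ℕ → Set
PairLists n m = Fin n → Fin n → Fin m → Fin m → Bool

-- f(x ; a₁ , … , a_k), the k-tuple given as a function Fin k → V(H).
HomMap : ℕ → ℕ → ℕ → Set
HomMap n m k = Fin n → (Fin k → Fin m) → Fin m

record Consistent {n m : ℕ} (G : Digraph n) (H : Digraph m) (k : ℕ)
                  (L : Lists n m) (f : HomMap n m k) : Set where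
  field
    list-property : ∀ x (as : Fin k → Fin m) →
      (∀ i → T (L x (as i))) → T (L x (f x as))
    adjacency-property : ∀ x y (as bs : Fin k → Fin m) →
      (∀ i → T (L x (as i))) → (∀ i → T (L y (bs i))) →
      T (G x y) → (∀ i → T (H (as i) (bs i))) →
      T (H (f x as) (f y bs))

ACViolation : {n m : ℕ} → Digraph n → Digraph m → Lists n m → Fin n → Fin m → Set
ACViolation {n} {m} G H L x a =
  (Σ (Fin n) λ y → T (G x y) × (∀ (b : Fin m) → T (L y b) → T (H a b) → ⊥))
  ⊎ (Σ (Fin n) λ y → T (G y x) × (∀ (b : Fin m) → T (L y b) → T (H b a) → ⊥))

ACStep : {n m : ℕ} → Digraph n → Digraph m → Lists n m → Lists n m → Set
ACStep {n} {m} G H L L' =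
  Σ (Fin n) λ x → Σ (Fin m) λ a →
    T (L x a) × ACViolation G H L x a ×
    (∀ y b → L' y b ≡ (L y b ∧ not (⌊ x ≟ y ⌋ ∧ ⌊ a ≟ b ⌋)))

-- The while loop has terminated: no removal condition holds.
ACFinal : {n m : ℕ} → Digraph n → Digraph m → Lists n m → Set
ACFinal G H L = ∀ x a → T (L x a) → ¬ ACViolation G H L x a

-- Initialisation: L(x,y) = L(x) × L(y), L(x,x) = {(a,a) : a ∈ L(x)},
-- then for each arc xy of G remove (a,b) with ab ∉ A(H).
PCInit : {n m : ℕ} → Digraph n → Digraph m → Lists n m → PairLists n m
PCInit G H L x y a b =
  (if ⌊ x ≟ y ⌋ then (⌊ a ≟ b ⌋ ∧ L x a) else (L x a ∧ L y b))
  ∧ (not (G x y) ∨ H a b)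

PCViolation : {n m : ℕ} → Lists n m → PairLists n m →
              Fin n → Fin n → Fin m → Fin m → Set
PCViolation {n} {m} L P x y a b =
  Σ (Fin n) λ z → ∀ (c : Fin m) → T (L z c) → T (P x z a c) → T (P z y c b) → ⊥

PCStep : {n m : ℕ} → Digraph n → Digraph m → Lists n m →
         PairLists n m → PairLists n m → Set
PCStep {n} {m} G H L P P' =
  Σ (Fin n) λ x → Σ (Fin n) λ y → Σ (Fin m) λ a → Σ (Fin m) λ b →
    T (P x y a b) × PCViolation L P x y a b ×
    (∀ x' y' a' b' → P' x' y' a' b' ≡
       (P x' y' a' b' ∧ not (⌊ x ≟ x' ⌋ ∧ ⌊ y ≟ y' ⌋ ∧ ⌊ a ≟ a' ⌋ ∧ ⌊ b ≟ b' ⌋)))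

PCFinal : {n m : ℕ} → Lists n m → PairLists n m → Set
PCFinal L P = ∀ x y a b → T (P x y a b) → ¬ PCViolation L P x y a b

-- Updated lists after PreProcessing: L^new(x) = {a : (a,a) ∈ L(x,x)}.
DiagLists : {n m : ℕ} → PairLists n m → Lists n m
DiagLists P x a = P x x a a

-- Both phases only delete a value (or a pair of values) that lacks support, and f never
-- produces such a value. Along ArcConsistency, f keeps its values on tuples from the final
-- lists L₁: if f(x; a) lost support along an arc xy, arc consistency of L₁ gives supports
-- bᵢ ∈ L₁(y) of the aᵢ, and by adjacency f(y; b) supports f(x; a). Along PairConsistency,
-- (f(x; a), f(y; b)) stays in L(x,y) whenever every (aᵢ, bᵢ) lies in the final P(x,y):
-- pair consistency of P routes each (aᵢ, bᵢ) through any z via some cᵢ, and f(z; c) is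
-- the required support. The case x = y, a = b is the theorem.

module Submission where

open import Defs
open import Data.Nat using (ℕ; _≤_)
open import Data.Fin using (Fin; _≟_)
open import Data.Fin.Properties using (any?)
open import Data.Bool using (Bool; true; false; T; _∧_; _∨_; not; if_then_else_)
open import Data.Bool.Properties using (T-∧; T-≡; T-not-≡)
open import Data.Product using (∃; _×_; _,_; proj₁; proj₂)
open import Data.Sum using (inj₁; inj₂)
open import Data.Unit using (tt)
open import Data.Empty using (⊥-elim)
open import Function using (_∘_; Equivalence)
open import Relation.Nullary using (¬_; yes; no)
open import Relation.Nullary.Decidable
  using (⌊_⌋; toWitness; fromWitness; fromWitnessFalse; decidable-stable; T?; _×-dec_)
open import Relation.Binary.PropositionalEquality using (_≡_; _≢_; refl; sym; cong₂; subst; subst₂)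
open import Relation.Binary.Construct.Closure.ReflexiveTransitive using (Star; fold)

open Equivalence using (to; from)

private
  variable
    n m k : ℕ
    x y x′ y′ : Fin n
    a b a′ b′ : Fin m

T-removal⇒ : ∀ {q q′ d} → q′ ≡ (q ∧ not d) → T q′ → T q
T-removal⇒ refl = proj₁ ∘ to T-∧

T-removal-kept : ∀ {q q′ d} → q′ ≡ (q ∧ not d) → T q → ¬ T d → T q′
T-removal-kept {true} {d = false} refl _ _  = tt
T-removal-kept {true} {d = true}  refl _ ¬d = ⊥-elim (¬d tt)

⌊≟⌋-refl : (x : Fin n) → ⌊ x ≟ x ⌋ ≡ true
⌊≟⌋-refl x = to T-≡ (fromWitness refl)

⌊≟⌋-≢ : x ≢ y → ⌊ x ≟ y ⌋ ≡ false
⌊≟⌋-≢ = to T-not-≡ ∘ fromWitnessFalse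

T-≟∧≟ : T (⌊ x ≟ x′ ⌋ ∧ ⌊ a ≟ a′ ⌋) → x ≡ x′ × a ≡ a′
T-≟∧≟ {x = x} {x′ = x′} {a = a} {a′ = a′} t with x ≟ x′ | a ≟ a′
... | yes x≡x′ | yes a≡a′ = x≡x′ , a≡a′

T-≟∧≟∧≟∧≟ : T (⌊ x ≟ x′ ⌋ ∧ ⌊ y ≟ y′ ⌋ ∧ ⌊ a ≟ a′ ⌋ ∧ ⌊ b ≟ b′ ⌋) →
            x ≡ x′ × y ≡ y′ × a ≡ a′ × b ≡ b′
T-≟∧≟∧≟∧≟ {x = x} {x′ = x′} {y = y} {y′ = y′} t with x ≟ x′ | y ≟ y′
... | yes x≡x′ | yes y≡y′ = x≡x′ , y≡y′ , T-≟∧≟ t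

T-not∨⇒ : ∀ {g h} → T (not g ∨ h) → T g → T h
T-not∨⇒ {true} t _ = t

T-not∨⇐ : ∀ {g h} → (T g → T h) → T (not g ∨ h)
T-not∨⇐ {true}  g⇒h = g⇒h tt
T-not∨⇐ {false} _   = tt

Star-invariant : ∀ {i ℓ p} {I : Set i} {R : I → I → Set ℓ} (Inv : I → Set p) →
                 (∀ {u v} → R u v → Inv u → Inv v) →
                 ∀ {u v} → Star R u v → Inv u → Inv v
Star-invariant Inv step = fold (λ u v → Inv u → Inv v) (λ r rest → rest ∘ step r) (λ inv → inv)

_⊆ˡ_ : Lists n m → Lists n m → Set
L′ ⊆ˡ L = ∀ x a → T (L′ x a) → T (L x a)

Consistent-restrict : {G : Digraph n} {H : Digraph m} {L L′ : Lists n m} {f : HomMap n m k} →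
  L′ ⊆ˡ L → (∀ x as → (∀ i → T (L′ x (as i))) → T (L′ x (f x as))) →
  Consistent G H k L f → Consistent G H k L′ f
Consistent-restrict L′⊆L list-property′ consistent = record
  { list-property = list-property′
  ; adjacency-property = λ x y as bs las lbs →
      adjacency-property x y as bs (L′⊆L x _ ∘ las) (L′⊆L y _ ∘ lbs)
  }
  where open Consistent consistent

module ArcConsistency-properties (G : Digraph n) (H : Digraph m) where

  ACStep⇒⊆ : ∀ {Q Q′} → ACStep G H Q Q′ → Q′ ⊆ˡ Q
  ACStep⇒⊆ (_ , _ , _ , _ , removal) x a = T-removal⇒ (removal x a)

  Star-ACStep⇒⊆ : ∀ {Q Q′} → Star (ACStep G H) Q Q′ → Q′ ⊆ˡ Q
  Star-ACStep⇒⊆ = fold (λ Q Q′ → Q′ ⊆ˡ Q)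
    (λ step rest x a → ACStep⇒⊆ step x a ∘ rest x a) (λ _ _ q → q)

  ACStep-kept : ∀ {Q Q′} → ACStep G H Q Q′ →
                T (Q x a) → ¬ ACViolation G H Q x a → T (Q′ x a)
  ACStep-kept {x = x} {a = a} {Q = Q} (_ , _ , _ , violation , removal) qxa ¬violation =
    T-removal-kept (removal x a) qxa λ removed →
      let x₀≡x , a₀≡a = T-≟∧≟ removed in
      ¬violation (subst₂ (ACViolation G H Q) x₀≡x a₀≡a violation)

  ACFinal⇒out-neighbour : ∀ {L} → ACFinal G H L → T (L x a) → T (G x y) →
                          ∃ λ b → T (L y b) × T (H a b)
  ACFinal⇒out-neighbour {x = x} {a = a} {y = y} {L = L} final lxa gxy =
    decidable-stable (any? λ b → T? (L y b) ×-dec T? (H a b)) λ none →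
      final x a lxa (inj₁ (y , gxy , λ b lyb hab → none (b , lyb , hab)))

  ACFinal⇒in-neighbour : ∀ {L} → ACFinal G H L → T (L x a) → T (G y x) →
                         ∃ λ b → T (L y b) × T (H b a)
  ACFinal⇒in-neighbour {x = x} {a = a} {y = y} {L = L} final lxa gyx =
    decidable-stable (any? λ b → T? (L y b) ×-dec T? (H b a)) λ none →
      final x a lxa (inj₂ (y , gyx , λ b lyb hba → none (b , lyb , hba)))

module _ {G : Digraph n} {H : Digraph m} {L L₁ : Lists n m} {f : HomMap n m k}
         (consistent : Consistent G H k L f) (L₁⊆L : L₁ ⊆ˡ L) (final : ACFinal G H L₁)
         where
  open Consistent consistent
  open ArcConsistency-properties G H

  f[L₁]⊆ : Lists n m → Set
  f[L₁]⊆ Q = ∀ x as → (∀ i → T (L₁ x (as i))) → T (Q x (f x as))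

  f[L₁]-avoids-ACViolation : ∀ {Q x} {as : Fin k → Fin m} → f[L₁]⊆ Q →
    (∀ i → T (L₁ x (as i))) → ¬ ACViolation G H Q x (f x as)
  f[L₁]-avoids-ACViolation {x = x} {as} image las (inj₁ (y , gxy , none)) =
    none (f y bs) (image y bs (proj₁ ∘ lbs,hbs))
      (adjacency-property x y as bs (L₁⊆L x _ ∘ las) (L₁⊆L y _ ∘ proj₁ ∘ lbs,hbs) gxy
        (proj₂ ∘ lbs,hbs))
    where
      neighbour : ∀ i → ∃ λ b → T (L₁ y b) × T (H (as i) b)
      neighbour i = ACFinal⇒out-neighbour final (las i) gxy
      bs = proj₁ ∘ neighbour
      lbs,hbs = proj₂ ∘ neighbour
  f[L₁]-avoids-ACViolation {x = x} {as} image las (inj₂ (y , gyx , none)) =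
    none (f y bs) (image y bs (proj₁ ∘ lbs,hbs))
      (adjacency-property y x bs as (L₁⊆L y _ ∘ proj₁ ∘ lbs,hbs) (L₁⊆L x _ ∘ las) gyx
        (proj₂ ∘ lbs,hbs))
    where
      neighbour : ∀ i → ∃ λ b → T (L₁ y b) × T (H b (as i))
      neighbour i = ACFinal⇒in-neighbour final (las i) gyx
      bs = proj₁ ∘ neighbour
      lbs,hbs = proj₂ ∘ neighbour

  f[L₁]⊆-ACStep : ∀ {Q Q′} → ACStep G H Q Q′ → f[L₁]⊆ Q → f[L₁]⊆ Q′
  f[L₁]⊆-ACStep step image x as las =
    ACStep-kept step (image x as las) (f[L₁]-avoids-ACViolation image las)

arcConsistency-preserves-Consistent :
  {G : Digraph n} {H : Digraph m} {L L₁ : Lists n m} {f : HomMap n m k} →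
  Consistent G H k L f → Star (ACStep G H) L L₁ → ACFinal G H L₁ → Consistent G H k L₁ f
arcConsistency-preserves-Consistent {G = G} {H} {L₁ = L₁} consistent run final =
  Consistent-restrict L₁⊆L
    (Star-invariant (f[L₁]⊆ consistent L₁⊆L final) (f[L₁]⊆-ACStep consistent L₁⊆L final) run
      (λ x as las → list-property x as (L₁⊆L x _ ∘ las)))
    consistent
  where
    open Consistent consistent
    L₁⊆L = ArcConsistency-properties.Star-ACStep⇒⊆ G H run

_⊆ᵖ_ : PairLists n m → PairLists n m → Set
P′ ⊆ᵖ P = ∀ x y a b → T (P′ x y a b) → T (P x y a b)

module PairConsistency-properties (G : Digraph n) (H : Digraph m) (M : Lists n m) where

  PCStep⇒⊆ : ∀ {Q Q′} → PCStep G H M Q Q′ → Q′ ⊆ᵖ Q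
  PCStep⇒⊆ (_ , _ , _ , _ , _ , _ , removal) x y a b = T-removal⇒ (removal x y a b)

  Star-PCStep⇒⊆ : ∀ {Q Q′} → Star (PCStep G H M) Q Q′ → Q′ ⊆ᵖ Q
  Star-PCStep⇒⊆ = fold (λ Q Q′ → Q′ ⊆ᵖ Q)
    (λ step rest x y a b → PCStep⇒⊆ step x y a b ∘ rest x y a b) (λ _ _ _ _ q → q)

  PCStep-kept : ∀ {Q Q′} → PCStep G H M Q Q′ →
                T (Q x y a b) → ¬ PCViolation M Q x y a b → T (Q′ x y a b)
  PCStep-kept {x = x} {y = y} {a = a} {b = b} {Q = Q}
              (_ , _ , _ , _ , _ , violation , removal) qxyab ¬violation =
    T-removal-kept (removal x y a b) qxyab λ removed →
      let x₀≡x , y₀≡y , a₀≡a , b₀≡b = T-≟∧≟∧≟∧≟ removed in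
      ¬violation (subst₂ (λ (x , y) (a , b) → PCViolation M Q x y a b)
                         (cong₂ _,_ x₀≡x y₀≡y) (cong₂ _,_ a₀≡a b₀≡b) violation)

  PCInit-lists PCInit-arc : Fin n → Fin n → Fin m → Fin m → Bool
  PCInit-lists x y a b = if ⌊ x ≟ y ⌋ then (⌊ a ≟ b ⌋ ∧ M x a) else (M x a ∧ M y b)
  PCInit-arc x y a b = not (G x y) ∨ H a b

  PCInit⇒lists : T (PCInit G H M x y a b) → T (M x a) × T (M y b)
  PCInit⇒lists {x = x} {y = y} {a = a} {b = b} t
    with lists ← proj₁ (to (T-∧ {PCInit-lists x y a b} {PCInit-arc x y a b}) t) | x ≟ y
  ... | yes refl = let a≟b , mxa = to (T-∧ {⌊ a ≟ b ⌋} {M x a}) lists in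
                   mxa , subst (T ∘ M x) (toWitness a≟b) mxa
  ... | no _     = to (T-∧ {M x a} {M y b}) lists

  PCInit⇒diagonal : T (PCInit G H M x x a b) → a ≡ b
  PCInit⇒diagonal {x = x} {a = a} {b = b} t
    with lists ← proj₁ (to (T-∧ {PCInit-lists x x a b} {PCInit-arc x x a b}) t) | x ≟ x
  ... | yes _  = toWitness (proj₁ (to (T-∧ {⌊ a ≟ b ⌋} {M x a}) lists))
  ... | no x≢x = ⊥-elim (x≢x refl)

  PCInit⇒arc : T (PCInit G H M x y a b) → T (G x y) → T (H a b)
  PCInit⇒arc {x = x} {y = y} {a = a} {b = b} =
    T-not∨⇒ ∘ proj₂ ∘ to (T-∧ {PCInit-lists x y a b} {PCInit-arc x y a b})

  PCInit-diagonal : T (M x a) → (T (G x x) → T (H a a)) → T (PCInit G H M x x a a)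
  PCInit-diagonal {x = x} {a = a} mxa arc
    rewrite ⌊≟⌋-refl x | ⌊≟⌋-refl a = from T-∧ (mxa , T-not∨⇐ arc)

  PCInit-off-diagonal : x ≢ y → T (M x a) → T (M y b) → (T (G x y) → T (H a b)) →
                        T (PCInit G H M x y a b)
  PCInit-off-diagonal x≢y mxa myb arc
    rewrite ⌊≟⌋-≢ x≢y = from T-∧ (from T-∧ (mxa , myb) , T-not∨⇐ arc)

module _ {G : Digraph n} {H : Digraph m} {M : Lists n m} {f : HomMap n m k}
         (consistent : Consistent G H k M f) {P : PairLists n m}
         (P⊆init : P ⊆ᵖ PCInit G H M) (final : PCFinal M P)
         where
  open Consistent consistent
  open PairConsistency-properties G H M

  P⇒lists : T (P x y a b) → T (M x a) × T (M y b)
  P⇒lists = PCInit⇒lists ∘ P⊆init _ _ _ _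

  P⇒diagonal : T (P x x a b) → a ≡ b
  P⇒diagonal = PCInit⇒diagonal ∘ P⊆init _ _ _ _

  P⇒arc : T (P x y a b) → T (G x y) → T (H a b)
  P⇒arc = PCInit⇒arc ∘ P⊆init _ _ _ _

  P-path : T (P x y a b) → ∀ z → ∃ λ c → T (M z c) × T (P x z a c) × T (P z y c b)
  P-path {x = x} {y = y} {a = a} {b = b} pxyab z =
    decidable-stable (any? λ c → T? (M z c) ×-dec T? (P x z a c) ×-dec T? (P z y c b)) λ none →
      final x y a b pxyab (z , λ c mzc pxzac pzycb → none (c , mzc , pxzac , pzycb))

  P⇒left-loop : T (P x y a b) → T (P x x a a)
  P⇒left-loop {x = x} {a = a} pxyab with _ , _ , pxxac , _ ← P-path pxyab x =
    subst (T ∘ P x x a) (sym (P⇒diagonal pxxac)) pxxac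

  P⇒right-loop : T (P x y a b) → T (P y y b b)
  P⇒right-loop {y = y} {b = b} pxyab with _ , _ , _ , pyycb ← P-path pxyab y =
    subst (λ c → T (P y y c b)) (P⇒diagonal pyycb) pyycb

  -- Pointwise equal tuples cannot be identified without function extensionality,
  -- so on the diagonal the two tuples are required to be the same function.
  data Compatible : Fin n → Fin n → (Fin k → Fin m) → (Fin k → Fin m) → Set where
    diagonal     : ∀ {x as} → (∀ i → T (P x x (as i) (as i))) → Compatible x x as as
    off-diagonal : ∀ {x y as bs} → x ≢ y → (∀ i → T (P x y (as i) (bs i))) →
                   Compatible x y as bs

  Compatible⇒pairs : ∀ {as bs} → Compatible x y as bs → ∀ i → T (P x y (as i) (bs i))
  Compatible⇒pairs (diagonal loops)       = loops
  Compatible⇒pairs (off-diagonal _ pairs) = pairs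

  Compatible⇒lists : ∀ {as bs} → Compatible x y as bs →
                     (∀ i → T (M x (as i))) × (∀ i → T (M y (bs i)))
  Compatible⇒lists compatible =
    proj₁ ∘ P⇒lists ∘ Compatible⇒pairs compatible , proj₂ ∘ P⇒lists ∘ Compatible⇒pairs compatible

  Pointwise-path : ∀ {as bs : Fin k → Fin m} → (∀ i → T (P x y (as i) (bs i))) → ∀ z →
    ∃ λ cs → (∀ i → T (P x z (as i) (cs i))) × (∀ i → T (P z y (cs i) (bs i)))
  Pointwise-path pairs z =
    proj₁ ∘ path , proj₁ ∘ proj₂ ∘ proj₂ ∘ path , proj₂ ∘ proj₂ ∘ proj₂ ∘ path
    where path = λ i → P-path (pairs i) z

  Compatible-split : ∀ {as bs} → Compatible x y as bs → ∀ z →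
    ∃ λ cs → Compatible x z as cs × Compatible z y cs bs
  Compatible-split {x = x} (diagonal loops) z with z ≟ x
  ... | yes refl = _ , diagonal loops , diagonal loops
  ... | no z≢x   = let cs , pairs₁ , pairs₂ = Pointwise-path loops z in
                   cs , off-diagonal (z≢x ∘ sym) pairs₁ , off-diagonal z≢x pairs₂
  Compatible-split {x = x} {y = y} (off-diagonal x≢y pairs) z with z ≟ x | z ≟ y
  ... | yes refl | _        = _ , diagonal (P⇒left-loop ∘ pairs) , off-diagonal x≢y pairs
  ... | no _     | yes refl = _ , off-diagonal x≢y pairs , diagonal (P⇒right-loop ∘ pairs)
  ... | no z≢x   | no z≢y   = let cs , pairs₁ , pairs₂ = Pointwise-path pairs z in
                              cs , off-diagonal (z≢x ∘ sym) pairs₁ , off-diagonal z≢y pairs₂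

  f[Compatible]⊆ : PairLists n m → Set
  f[Compatible]⊆ Q = ∀ {x y as bs} → Compatible x y as bs → T (Q x y (f x as) (f y bs))

  f[Compatible]⊆-PCInit : f[Compatible]⊆ (PCInit G H M)
  f[Compatible]⊆-PCInit (diagonal {x} {as} loops) =
    PCInit-diagonal (list-property x as mas) λ gxx →
      adjacency-property x x as as mas mas gxx (λ i → P⇒arc (loops i) gxx)
    where
      mas = proj₁ (Compatible⇒lists (diagonal loops))
  f[Compatible]⊆-PCInit (off-diagonal {x} {y} {as} {bs} x≢y pairs) =
    PCInit-off-diagonal x≢y (list-property x as mas) (list-property y bs mbs) λ gxy →
      adjacency-property x y as bs mas mbs gxy (λ i → P⇒arc (pairs i) gxy)
    where
      mas,mbs = Compatible⇒lists (off-diagonal x≢y pairs)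
      mas = proj₁ mas,mbs
      mbs = proj₂ mas,mbs

  f[Compatible]-avoids-PCViolation : ∀ {Q as bs} → f[Compatible]⊆ Q → Compatible x y as bs →
    ¬ PCViolation M Q x y (f x as) (f y bs)
  f[Compatible]-avoids-PCViolation image compatible (z , none)
    with cs , compatible₁ , compatible₂ ← Compatible-split compatible z =
    none (f z cs) (list-property z cs (proj₂ (Compatible⇒lists compatible₁)))
      (image compatible₁) (image compatible₂)

  f[Compatible]⊆-PCStep : ∀ {Q Q′} → PCStep G H M Q Q′ → f[Compatible]⊆ Q → f[Compatible]⊆ Q′
  f[Compatible]⊆-PCStep {Q} step image compatible =
    PCStep-kept step (image compatible)
      (f[Compatible]-avoids-PCViolation {Q = Q} image compatible)

pairConsistency-preserves-Consistent :
  {G : Digraph n} {H : Digraph m} {M : Lists n m} {f : HomMap n m k} {P : PairLists n m} →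
  Consistent G H k M f → Star (PCStep G H M) (PCInit G H M) P → PCFinal M P →
  Consistent G H k (DiagLists P) f
pairConsistency-preserves-Consistent {G = G} {H} {M} consistent run final =
  Consistent-restrict (λ x a → proj₁ ∘ P⇒lists consistent P⊆init final)
    (λ x as loops →
      Star-invariant (f[Compatible]⊆ consistent P⊆init final)
        (f[Compatible]⊆-PCStep consistent P⊆init final) run
        (f[Compatible]⊆-PCInit consistent P⊆init final) (diagonal loops))
    consistent
  where
    P⊆init = PairConsistency-properties.Star-PCStep⇒⊆ G H M run

lemma1 : (n m : ℕ) (G : Digraph n) (H : Digraph m) (k : ℕ) → 2 ≤ k →
    (L : Lists n m) (f : HomMap n m k) → Consistent G H k L f →
    (L₁ : Lists n m) → Star (ACStep G H) L L₁ → ACFinal G H L₁ →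
    (P : PairLists n m) → Star (PCStep G H L₁) (PCInit G H L₁) P → PCFinal L₁ P →
    Consistent G H k (DiagLists P) f
lemma1 _ _ _ _ _ _ _ _ consistent _ arcRun arcFinal _ pairRun pairFinal =
  pairConsistency-preserves-Consistent
    (arcConsistency-preserves-Consistent consistent arcRun arcFinal) pairRun pairFinal
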